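{- Let $G$ be a graph with a dominating vertex. If $\overline{G}$ has a pendant vertex that is not part of a connected component isomorphic to $P_2$, then $G$ is not $(n,\ell)$-extremal for any $n$ and $\ell$.
   Context: All graphs are finite and simple; labels lie in $\mathbb{Z}_\ell$. In the neighborhood Lights Out game on a graph $G$, each vertex carries a label in $\mathbb{Z}_\ell$; toggling a vertex $v$ adds $1$ (mod $\ell$) to the label of every vertex of the closed neighborhood $N[v]$; the game is won when all labels are $0$. $G$ is $N$-AW if the game can be won from every initial labeling. $\max(n,\ell)$ is the maximum number of edges of an $N$-AW graph on $n$ vertices; an $(n,\ell)$-extremal graph is an $N$-AW graph on $n$ vertices with $\max(n,\ell)$ edges. A dominating vertex is one adjacent to all other vertices; a pendant vertex has degree $1$; $P_2$ is a single edge; $\overline{G}$ is the complement of $G$. -}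

module Defs where

open import Data.Nat using (ℕ; zero; suc; _+_; _≤_; _<_; _%_; NonZero)
open import Data.Fin using (Fin; zero; suc; toℕ; _≟_)
open import Data.Bool using (Bool; true; false; not; if_then_else_; _∧_; _∨_)
open import Data.Product using (Σ; ∃; _×_; _,_)
open import Data.Sum using (_⊎_)
open import Relation.Nullary using (¬_; yes; no)
open import Relation.Nullary.Decidable using (⌊_⌋)
open import Relation.Binary.PropositionalEquality using (_≡_; _≢_; refl; sym)

record Graph (n : ℕ) : Set where
  field
    adj    : Fin n → Fin n → Bool
    symm   : ∀ i j → adj i j ≡ adj j i
    irrefl : ∀ i → adj i i ≡ false
open Graph public

∑ : ∀ {n} → (Fin n → ℕ) → ℕ
∑ {zero}  f = 0
∑ {suc n} f = f zero + ∑ (λ i → f (suc i))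

edges : ∀ {n} → Graph n → ℕ
edges G = ∑ (λ i → ∑ (λ j → if adj G i j ∧ ⌊ toℕ i Data.Nat.<? toℕ j ⌋ then 1 else 0))

degree : ∀ {n} → Graph n → Fin n → ℕ
degree G v = ∑ (λ u → if adj G v u then 1 else 0)

closedNbr : ∀ {n} → Graph n → Fin n → Fin n → Bool
closedNbr G v u = ⌊ v ≟ u ⌋ ∨ adj G v u

-- Neighborhood Lights Out over ℤ_ℓ: labels are represented by natural numbers
-- taken mod ℓ; a strategy says how often each vertex is toggled.
Winnable : ∀ {n} → Graph n → (ℓ : ℕ) → .{{NonZero ℓ}} → (Fin n → ℕ) → Set
Winnable {n} G ℓ init =
  ∃ λ (x : Fin n → ℕ) → ∀ v → (init v + ∑ (λ u → if closedNbr G v u then x u else 0)) % ℓ ≡ 0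

NAW : ∀ {n} → Graph n → (ℓ : ℕ) → .{{NonZero ℓ}} → Set
NAW {n} G ℓ = ∀ (init : Fin n → ℕ) → Winnable G ℓ init

Extremal : (n ℓ : ℕ) → .{{NonZero ℓ}} → Graph n → Set
Extremal n ℓ G = NAW G ℓ × (∀ (H : Graph n) → NAW H ℓ → edges H ≤ edges G)

Dominating : ∀ {n} → Graph n → Fin n → Set
Dominating G v = ∀ u → u ≢ v → adj G v u ≡ true

HasDominating : ∀ {n} → Graph n → Set
HasDominating {n} G = ∃ λ (v : Fin n) → Dominating G v

cadj : ∀ {n} → Graph n → Fin n → Fin n → Bool
cadj G i j with i ≟ j
... | yes _ = false
... | no  _ = not (adj G i j)

private
  csym : ∀ {n} (G : Graph n) i j → cadj G i j ≡ cadj G j i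
  csym G i j with i ≟ j | j ≟ i
  ... | yes _ | yes _ = refl
  ... | yes refl | no ne = Data.Empty.⊥-elim (ne refl)
    where import Data.Empty
  ... | no ne | yes refl = Data.Empty.⊥-elim (ne refl)
    where import Data.Empty
  ... | no _ | no _ rewrite symm G i j = refl

  cirr : ∀ {n} (G : Graph n) i → cadj G i i ≡ false
  cirr G i with i ≟ i
  ... | yes _ = refl
  ... | no ne = Data.Empty.⊥-elim (ne refl)
    where import Data.Empty

complement : ∀ {n} → Graph n → Graph n
complement G = record { adj = cadj G ; symm = csym G ; irrefl = cirr G }

Pendant : ∀ {n} → Graph n → Fin n → Set
Pendant G v = degree G v ≡ 1

data Reach {n} (G : Graph n) (v : Fin n) : Fin n → Set where
  here : Reach G v v
  step : ∀ {u w} → Reach G v u → adj G u w ≡ true → Reach G v w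

ComponentIsP2 : ∀ {n} → Graph n → Fin n → Set
ComponentIsP2 {n} G v =
  ∃ λ (w : Fin n) → v ≢ w × adj G v w ≡ true × (∀ u → Reach G v u → u ≡ v ⊎ u ≡ w)

-- Let d dominate G, let q be the unique non-neighbour of p (p is pendant in the complement), and let
-- r ≠ p be a second non-neighbour of q, which exists because p does not lie in a P₂ component of the
-- complement. Adding the edge qr keeps G N-AW, so G does not have the maximum number of edges.
-- Given labels I on G + qr, solve on G the labels that add I p - I d at r, getting y. Since
-- N[d] = N[p] ∪ {q}, the equations at p and d force y q ≡ I p - I d, which is exactly what the new
-- edge delivers to r; the remaining discrepancy, y r at q, is cancelled by pressing p and d.
module Submission where

open import Defs
open import Data.Nat using (ℕ; zero; suc; _+_; _*_; _≤_; _<_; _<?_; pred; z≤n; s≤s; NonZero; ≢-nonZero⁻¹)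
open import Data.Nat.Properties using (module ≤-Reasoning; ≤-refl; +-mono-≤; +-suc; +-assoc; +-identityʳ; +-cancelʳ-≡; <-cmp; <⇒≱)
open import Data.Nat.Divisibility using (_∣_; m%n≡0⇒n∣m; n∣m⇒m%n≡0; ∣m∣n⇒∣m+n; ∣m+n∣m⇒∣n; ∣n⇒∣m*n; m∣m*n)
open import Data.Nat.Tactic.RingSolver using (solve-∀)
open import Data.Fin using (Fin; zero; suc; toℕ; _≟_)
open import Data.Fin.Properties using (any?; suc-injective; toℕ-injective)
open import Data.Bool using (Bool; true; false; not; if_then_else_; _∧_; _∨_)
open import Data.Bool.Properties as Bool using (not-involutive; ∨-identityʳ; ∨-zeroʳ; ∨-conicalʳ)
open import Data.Product using (∃; _×_; _,_; proj₁; proj₂)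
open import Data.Sum using (_⊎_; inj₁; inj₂)
open import Function using (_∘_)
open import Function.Bundles using (mk⇔)
open import Relation.Binary.Definitions using (tri<; tri≈; tri>)
open import Relation.Binary.PropositionalEquality using (_≡_; _≢_; refl; sym; trans; cong; cong₂; subst; module ≡-Reasoning)
open import Relation.Nullary using (¬_; ¬?; Dec; yes; no; does; contradiction)
open import Relation.Nullary.Decidable using (⌊_⌋; _×-dec_; _⊎-dec_; dec-true; dec-false; does-⇔; isYes≗does)

∑-cong : ∀ {n} {f g : Fin n → ℕ} → (∀ i → f i ≡ g i) → ∑ f ≡ ∑ g
∑-cong {zero}  f≗g = refl
∑-cong {suc n} f≗g = cong₂ _+_ (f≗g zero) (∑-cong (f≗g ∘ suc))

∑-mono-≤ : ∀ {n} {f g : Fin n → ℕ} → (∀ i → f i ≤ g i) → ∑ f ≤ ∑ g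
∑-mono-≤ {zero}  f≤g = z≤n
∑-mono-≤ {suc n} f≤g = +-mono-≤ (f≤g zero) (∑-mono-≤ (f≤g ∘ suc))

∑-mono-< : ∀ {n} {f g : Fin n → ℕ} → (∀ i → f i ≤ g i) → ∀ w → f w < g w → ∑ f < ∑ g
∑-mono-< {suc n}         f≤g zero    fw<gw = +-mono-≤ fw<gw (∑-mono-≤ (f≤g ∘ suc))
∑-mono-< {suc n} {f} {g} f≤g (suc w) fw<gw = begin
  suc (f zero + ∑ (f ∘ suc)) ≡⟨ +-suc (f zero) _ ⟨
  f zero + suc (∑ (f ∘ suc)) ≤⟨ +-mono-≤ (f≤g zero) (∑-mono-< (f≤g ∘ suc) w fw<gw) ⟩
  g zero + ∑ (g ∘ suc)       ∎
  where open ≤-Reasoning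

∑-exchange-at : ∀ {n} (f g : Fin n → ℕ) w → (∀ u → u ≢ w → f u ≡ g u) → ∑ f + g w ≡ ∑ g + f w
∑-exchange-at f g zero f≗g = begin
  f zero + ∑ (f ∘ suc) + g zero ≡⟨ cong (λ s → f zero + s + g zero) (∑-cong (λ u → f≗g (suc u) λ ())) ⟩
  f zero + ∑ (g ∘ suc) + g zero ≡⟨ exchange (f zero) (∑ (g ∘ suc)) (g zero) ⟩
  g zero + ∑ (g ∘ suc) + f zero ∎
  where
  open ≡-Reasoning
  exchange : ∀ a b c → a + b + c ≡ c + b + a
  exchange = solve-∀
∑-exchange-at f g (suc w) f≗g = begin
  f zero + ∑ (f ∘ suc) + g (suc w)   ≡⟨ cong (λ a → a + ∑ (f ∘ suc) + g (suc w)) (f≗g zero λ ()) ⟩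
  g zero + ∑ (f ∘ suc) + g (suc w)   ≡⟨ +-assoc (g zero) _ _ ⟩
  g zero + (∑ (f ∘ suc) + g (suc w)) ≡⟨ cong (g zero +_) (∑-exchange-at (f ∘ suc) (g ∘ suc) w λ u u≢w → f≗g (suc u) (u≢w ∘ suc-injective)) ⟩
  g zero + (∑ (g ∘ suc) + f (suc w)) ≡⟨ +-assoc (g zero) _ _ ⟨
  g zero + ∑ (g ∘ suc) + f (suc w)   ∎
  where open ≡-Reasoning

∑-indicator≡0 : ∀ {n} (b : Fin n → Bool) → ∑ (λ u → if b u then 1 else 0) ≡ 0 → ∀ u → b u ≡ false
∑-indicator≡0 {suc n} b sum≡0 u with b zero in b₀
∑-indicator≡0 b ()    u       | true
∑-indicator≡0 b sum≡0 zero    | false = b₀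
∑-indicator≡0 b sum≡0 (suc u) | false = ∑-indicator≡0 (b ∘ suc) sum≡0 u

∑-indicator≡1 : ∀ {n} (b : Fin n → Bool) → ∑ (λ u → if b u then 1 else 0) ≡ 1 →
                ∃ λ q → b q ≡ true × (∀ u → u ≢ q → b u ≡ false)
∑-indicator≡1 {suc n} b sum≡1 with b zero in b₀
... | true  = zero , b₀ , λ { zero 0≢0 → contradiction refl 0≢0
                            ; (suc u) _ → ∑-indicator≡0 (b ∘ suc) (cong pred sum≡1) u }
... | false with ∑-indicator≡1 (b ∘ suc) sum≡1
...   | q , bq , only-q = suc q , bq , λ { zero _ → b₀ ; (suc u) u≢q → only-q u (u≢q ∘ cong suc) }

∣-+-multiple : ∀ ℓ {a b} k → ℓ ∣ a + b → ℓ ∣ a + (b + ℓ * k)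
∣-+-multiple ℓ {a} {b} k ℓ∣a+b = subst (ℓ ∣_) (+-assoc a b (ℓ * k)) (∣m∣n⇒∣m+n ℓ∣a+b (m∣m*n k))

-- Modulo suc m, b + m * c is b - c, which the last two hypotheses make congruent to t.
∣-difference : ∀ m a b c e s t → suc m ∣ a + (b + m * c) + e → suc m ∣ b + s → suc m ∣ c + (s + t) →
               suc m ∣ a + (e + t)
∣-difference m a b c e s t h₁ h₂ h₃ =
  ∣m+n∣m⇒∣n (subst (suc m ∣_) (regroup m a b c e s t) (∣m∣n⇒∣m+n h₁ (m∣m*n (s + t))))
            (∣m∣n⇒∣m+n h₂ (∣n⇒∣m*n m h₃))
  where
  regroup : ∀ m a b c e s t → a + (b + m * c) + e + suc m * (s + t) ≡ b + s + m * (c + (s + t)) + (a + (e + t))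
  regroup = solve-∀

closedNbr-refl : ∀ {n} (G : Graph n) v → closedNbr G v v ≡ true
closedNbr-refl G v with v ≟ v
... | yes _   = refl
... | no v≢v = contradiction refl v≢v

closedNbr-sym : ∀ {n} (G : Graph n) u v → closedNbr G u v ≡ closedNbr G v u
closedNbr-sym G u v with u ≟ v | v ≟ u
... | yes _    | yes _    = refl
... | yes refl | no v≢v  = contradiction refl v≢v
... | no u≢u  | yes refl = contradiction refl u≢u
... | no _     | no _     = symm G u v

closedNbr-≢ : ∀ {n} (G : Graph n) {v u w} → closedNbr G v u ≡ true → closedNbr G v w ≡ false → u ≢ w
closedNbr-≢ G u∈N w∉N refl with () ← trans (sym u∈N) w∉N

closedNbr≡not-complement : ∀ {n} (G : Graph n) u v → closedNbr G u v ≡ not (adj (complement G) u v)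
closedNbr≡not-complement G u v with u ≟ v
... | yes _ = refl
... | no _  = sym (not-involutive (adj G u v))

dominating⇒closedNbr : ∀ {n} (G : Graph n) {d} → Dominating G d → ∀ v → closedNbr G v d ≡ true
dominating⇒closedNbr G {d} d-dom v with v ≟ d
... | yes _   = refl
... | no v≢d = trans (symm G v d) (d-dom v v≢d)

toggles : ∀ {n} → Graph n → (Fin n → ℕ) → Fin n → ℕ
toggles G x v = ∑ (λ u → if closedNbr G v u then x u else 0)

toggles-gain : ∀ {n} (F F′ : Graph n) (x : Fin n → ℕ) {v v′ w} →
               (∀ u → u ≢ w → closedNbr F v u ≡ closedNbr F′ v′ u) →
               closedNbr F v w ≡ true → closedNbr F′ v′ w ≡ false →
               toggles F x v ≡ toggles F′ x v′ + x w
toggles-gain F F′ x {v} {v′} {w} agree w∈N w∉N′ = begin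
  toggles F x v                                      ≡⟨ +-identityʳ _ ⟨
  toggles F x v + 0                                  ≡⟨ cong (λ b → toggles F x v + (if b then x w else 0)) w∉N′ ⟨
  toggles F x v + (if closedNbr F′ v′ w then x w else 0) ≡⟨ ∑-exchange-at _ _ w (λ u u≢w → cong (λ b → if b then x u else 0) (agree u u≢w)) ⟩
  toggles F′ x v′ + (if closedNbr F v w then x w else 0) ≡⟨ cong (λ b → toggles F′ x v′ + (if b then x w else 0)) w∈N ⟩
  toggles F′ x v′ + x w                              ∎
  where open ≡-Reasoning

bump : ∀ {n} → (Fin n → ℕ) → Fin n → ℕ → Fin n → ℕ
bump x w c u = if does (u ≟ w) then x u + c else x u

bump-here : ∀ {n} (x : Fin n → ℕ) w c → bump x w c w ≡ x w + c
bump-here x w c rewrite dec-true (w ≟ w) refl = refl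

bump-there : ∀ {n} (x : Fin n → ℕ) {w u} c → u ≢ w → bump x w c u ≡ x u
bump-there x {w} {u} c u≢w rewrite dec-false (u ≟ w) u≢w = refl

toggles-bump : ∀ {n} (G : Graph n) x w c v →
               toggles G (bump x w c) v ≡ toggles G x v + (if closedNbr G v w then c else 0)
toggles-bump G x w c v
  with ∑-exchange-at (λ u → if closedNbr G v u then bump x w c u else 0) (λ u → if closedNbr G v u then x u else 0) w
         (λ u u≢w → cong (λ y → if closedNbr G v u then y else 0) (bump-there x c u≢w))
... | exchanged rewrite bump-here x w c with closedNbr G v w
...   | true  = +-cancelʳ-≡ (x w) _ _ (trans exchanged (shift (toggles G x v) (x w) c))
  where
  shift : ∀ a b c → a + (b + c) ≡ a + c + b
  shift = solve-∀
...   | false = trans (sym (+-identityʳ _)) exchanged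

edge-indicator-mono : ∀ {a b : Bool} c → (a ≡ true → b ≡ true) → (if a ∧ c then 1 else 0) ≤ (if b ∧ c then 1 else 0)
edge-indicator-mono {false} c a⇒b = z≤n
edge-indicator-mono {true}  c a⇒b rewrite a⇒b refl = ≤-refl

edges-mono-< : ∀ {n} (G H : Graph n) → (∀ i j → adj G i j ≡ true → adj H i j ≡ true) →
               ∀ {i j} → toℕ i < toℕ j → adj G i j ≡ false → adj H i j ≡ true → edges G < edges H
edges-mono-< G H G⊆H {i} {j} i<j ij∉G ij∈H =
  ∑-mono-< (λ k → ∑-mono-≤ (λ l → edge-indicator-mono _ (G⊆H k l))) i
    (∑-mono-< (λ l → edge-indicator-mono _ (G⊆H i l)) j
      (new-edge ij∉G ij∈H (trans (isYes≗does (toℕ i <? toℕ j)) (dec-true (toℕ i <? toℕ j) i<j))))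
  where
  new-edge : ∀ {a b c} → a ≡ false → b ≡ true → c ≡ true → (if a ∧ c then 1 else 0) < (if b ∧ c then 1 else 0)
  new-edge refl refl refl = s≤s z≤n

Joins : ∀ {n} → Fin n → Fin n → Fin n → Fin n → Set
Joins q r i j = (i ≡ q × j ≡ r) ⊎ (i ≡ r × j ≡ q)

joins? : ∀ {n} (q r i j : Fin n) → Dec (Joins q r i j)
joins? q r i j = (i ≟ q ×-dec j ≟ r) ⊎-dec (i ≟ r ×-dec j ≟ q)

joins-sym : ∀ {n} {q r i j : Fin n} → Joins q r i j → Joins q r j i
joins-sym (inj₁ (i≡q , j≡r)) = inj₂ (j≡r , i≡q)
joins-sym (inj₂ (i≡r , j≡q)) = inj₁ (j≡q , i≡r)

joins-irrefl : ∀ {n} {q r i : Fin n} → q ≢ r → ¬ Joins q r i i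
joins-irrefl q≢r (inj₁ (refl , refl)) = q≢r refl
joins-irrefl q≢r (inj₂ (refl , refl)) = q≢r refl

addEdge : ∀ {n} (G : Graph n) {q r : Fin n} → q ≢ r → Graph n
addEdge G {q} {r} q≢r = record
  { adj    = λ i j → adj G i j ∨ does (joins? q r i j)
  ; symm   = λ i j → cong₂ _∨_ (symm G i j) (does-⇔ (mk⇔ joins-sym joins-sym) (joins? q r i j) (joins? q r j i))
  ; irrefl = λ i → cong₂ _∨_ (irrefl G i) (dec-false (joins? q r i i) (joins-irrefl q≢r))
  }

module _ {n} (G : Graph n) {q r : Fin n} (q≢r : q ≢ r) where

  adj-addEdge-⊇ : ∀ i j → adj G i j ≡ true → adj (addEdge G q≢r) i j ≡ true
  adj-addEdge-⊇ i j ij∈G rewrite ij∈G = refl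

  adj-addEdge-joined : ∀ {i j} → Joins q r i j → adj (addEdge G q≢r) i j ≡ true
  adj-addEdge-joined {i} {j} ij rewrite dec-true (joins? q r i j) ij = ∨-zeroʳ _

  closedNbr-addEdge : ∀ {v u} → ¬ Joins q r v u → closedNbr (addEdge G q≢r) v u ≡ closedNbr G v u
  closedNbr-addEdge {v} {u} ¬vu rewrite dec-false (joins? q r v u) ¬vu = cong (⌊ v ≟ u ⌋ ∨_) (∨-identityʳ _)

  closedNbr-addEdge-joined : ∀ {v u} → Joins q r v u → closedNbr (addEdge G q≢r) v u ≡ true
  closedNbr-addEdge-joined {v} {u} vu rewrite adj-addEdge-joined vu = ∨-zeroʳ _

  toggles-addEdge : ∀ x {v} → v ≢ q → v ≢ r → toggles (addEdge G q≢r) x v ≡ toggles G x v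
  toggles-addEdge x v≢q v≢r = ∑-cong λ u → cong (λ b → if b then x u else 0) (closedNbr-addEdge λ
    { (inj₁ (v≡q , _)) → v≢q v≡q
    ; (inj₂ (v≡r , _)) → v≢r v≡r })

  toggles-addEdge-q : closedNbr G q r ≡ false → ∀ x → toggles (addEdge G q≢r) x q ≡ toggles G x q + x r
  toggles-addEdge-q r∉N[q] x = toggles-gain (addEdge G q≢r) G x {q} {q}
    (λ u u≢r → closedNbr-addEdge λ { (inj₁ (_ , u≡r)) → u≢r u≡r ; (inj₂ (q≡r , _)) → q≢r q≡r })
    (closedNbr-addEdge-joined (inj₁ (refl , refl))) r∉N[q]

  toggles-addEdge-r : closedNbr G q r ≡ false → ∀ x → toggles (addEdge G q≢r) x r ≡ toggles G x r + x q
  toggles-addEdge-r r∉N[q] x = toggles-gain (addEdge G q≢r) G x {r} {r}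
    (λ u u≢q → closedNbr-addEdge λ { (inj₁ (r≡q , _)) → q≢r (sym r≡q) ; (inj₂ (_ , u≡q)) → u≢q u≡q })
    (closedNbr-addEdge-joined (inj₂ (refl , refl))) (trans (closedNbr-sym G r q) r∉N[q])

  edges-addEdge : adj G q r ≡ false → edges G < edges (addEdge G q≢r)
  edges-addEdge qr∉G with <-cmp (toℕ q) (toℕ r)
  ... | tri< q<r _ _ = edges-mono-< G (addEdge G q≢r) adj-addEdge-⊇ q<r qr∉G (adj-addEdge-joined (inj₁ (refl , refl)))
  ... | tri≈ _ q≡r _ = contradiction (toℕ-injective q≡r) q≢r
  ... | tri> _ _ r<q = edges-mono-< G (addEdge G q≢r) adj-addEdge-⊇ r<q (trans (symm G r q) qr∉G) (adj-addEdge-joined (inj₂ (refl , refl)))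

module _ {n} (G : Graph n) {d p q r : Fin n}
         (d∈N : ∀ v → closedNbr G v d ≡ true)
         (p∈N : ∀ v → v ≢ q → closedNbr G v p ≡ true)
         (p∉N[q] : closedNbr G q p ≡ false)
         (r∉N[q] : closedNbr G q r ≡ false)
         (r≢p : r ≢ p) where

  private
    q≢r : q ≢ r
    q≢r = closedNbr-≢ G (closedNbr-refl G q) r∉N[q]

    q≢p : q ≢ p
    q≢p = closedNbr-≢ G (closedNbr-refl G q) p∉N[q]

    q≢d : q ≢ d
    q≢d q≡d = closedNbr-≢ G (d∈N p) (trans (closedNbr-sym G p q) p∉N[q]) (sym q≡d)

    r≢d : r ≢ d
    r≢d r≡d = closedNbr-≢ G (d∈N q) r∉N[q] (sym r≡d)

  G+qr : Graph n
  G+qr = addEdge G q≢r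

  toggles-d≡toggles-p+q : ∀ y → toggles G y d ≡ toggles G y p + y q
  toggles-d≡toggles-p+q y = toggles-gain G G y {d} {p}
    (λ u u≢q → trans (closedNbr-sym G d u) (trans (d∈N u) (sym (trans (closedNbr-sym G p u) (p∈N u u≢q)))))
    (trans (closedNbr-sym G d q) (d∈N q)) (trans (closedNbr-sym G p q) p∉N[q])

  -- Each press of r in y is matched by one press of p and m of d: every vertex except q receives
  -- ℓ = suc m extra presses, and q receives m of them plus one from r through the new edge.
  compensated : ℕ → (Fin n → ℕ) → Fin n → ℕ
  compensated m y = bump (bump y p (y r)) d (m * y r)

  compensated-at : ∀ m y {u} → u ≢ p → u ≢ d → compensated m y u ≡ y u
  compensated-at m y u≢p u≢d = trans (bump-there (bump y p (y r)) (m * y r) u≢d) (bump-there y (y r) u≢p)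

  toggles-compensated : ∀ m y v →
    toggles G (compensated m y) v ≡ toggles G y v + (if closedNbr G v p then y r else 0) + m * y r
  toggles-compensated m y v = trans (toggles-bump G (bump y p (y r)) d (m * y r) v)
    (cong₂ _+_ (toggles-bump G y p (y r) v) (cong (λ b → if b then m * y r else 0) (d∈N v)))

  toggles-G+qr-compensated-q : ∀ m y → toggles G+qr (compensated m y) q ≡ toggles G y q + suc m * y r
  toggles-G+qr-compensated-q m y = begin
    toggles G+qr (compensated m y) q                    ≡⟨ toggles-addEdge-q G q≢r r∉N[q] _ ⟩
    toggles G (compensated m y) q + compensated m y r   ≡⟨ cong₂ _+_ (toggles-compensated m y q) (compensated-at m y r≢p r≢d) ⟩
    toggles G y q + (if closedNbr G q p then y r else 0) + m * y r + y r ≡⟨ cong (λ b → toggles G y q + (if b then y r else 0) + m * y r + y r) p∉N[q] ⟩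
    toggles G y q + 0 + m * y r + y r                   ≡⟨ regroup (toggles G y q) (y r) m ⟩
    toggles G y q + suc m * y r                         ∎
    where
    open ≡-Reasoning
    regroup : ∀ a k m → a + 0 + m * k + k ≡ a + suc m * k
    regroup = solve-∀

  toggles-G+qr-compensated-≢ : ∀ m y v → v ≢ q → v ≢ r → toggles G+qr (compensated m y) v ≡ toggles G y v + suc m * y r
  toggles-G+qr-compensated-≢ m y v v≢q v≢r = begin
    toggles G+qr (compensated m y) v                    ≡⟨ toggles-addEdge G q≢r _ v≢q v≢r ⟩
    toggles G (compensated m y) v                       ≡⟨ toggles-compensated m y v ⟩
    toggles G y v + (if closedNbr G v p then y r else 0) + m * y r ≡⟨ cong (λ b → toggles G y v + (if b then y r else 0) + m * y r) (p∈N v v≢q) ⟩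
    toggles G y v + y r + m * y r                       ≡⟨ +-assoc (toggles G y v) _ _ ⟩
    toggles G y v + suc m * y r                         ∎
    where open ≡-Reasoning

  toggles-G+qr-compensated : ∀ m y v → v ≢ r → toggles G+qr (compensated m y) v ≡ toggles G y v + suc m * y r
  toggles-G+qr-compensated m y v v≢r = by-cases (v ≟ q)
    where
    by-cases : Dec (v ≡ q) → toggles G+qr (compensated m y) v ≡ toggles G y v + suc m * y r
    by-cases (yes v≡q) = subst (λ u → toggles G+qr (compensated m y) u ≡ toggles G y u + suc m * y r) (sym v≡q)
                               (toggles-G+qr-compensated-q m y)
    by-cases (no v≢q)  = toggles-G+qr-compensated-≢ m y v v≢q v≢r

  toggles-G+qr-compensated-r : ∀ m y → toggles G+qr (compensated m y) r ≡ toggles G y r + y q + suc m * y r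
  toggles-G+qr-compensated-r m y = begin
    toggles G+qr (compensated m y) r                    ≡⟨ toggles-addEdge-r G q≢r r∉N[q] _ ⟩
    toggles G (compensated m y) r + compensated m y q   ≡⟨ cong₂ _+_ (toggles-compensated m y r) (compensated-at m y q≢p q≢d) ⟩
    toggles G y r + (if closedNbr G r p then y r else 0) + m * y r + y q ≡⟨ cong (λ b → toggles G y r + (if b then y r else 0) + m * y r + y q) (p∈N r (q≢r ∘ sym)) ⟩
    toggles G y r + y r + m * y r + y q                 ≡⟨ regroup (toggles G y r) (y r) (y q) m ⟩
    toggles G y r + y q + suc m * y r                   ∎
    where
    open ≡-Reasoning
    regroup : ∀ a k t m → a + k + m * k + t ≡ a + t + suc m * k
    regroup = solve-∀

  NAW-addEdge : ∀ ℓ .{{_ : NonZero ℓ}} → NAW G ℓ → NAW G+qr ℓ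
  NAW-addEdge zero    = contradiction refl (≢-nonZero⁻¹ 0)
  NAW-addEdge (suc m) naw I = compensated m y , λ v → n∣m⇒m%n≡0 _ _ (solves v)
    where
    I′ : Fin n → ℕ
    I′ = bump I r (I p + m * I d)

    y : Fin n → ℕ
    y = proj₁ (naw I′)

    y-solves : ∀ v → suc m ∣ I′ v + toggles G y v
    y-solves v = m%n≡0⇒n∣m _ _ (proj₂ (naw I′) v)

    y-solves-≢r : ∀ v → v ≢ r → suc m ∣ I v + toggles G y v
    y-solves-≢r v v≢r = subst (λ a → suc m ∣ a + toggles G y v) (bump-there I _ v≢r) (y-solves v)

    y-solves-r : suc m ∣ I r + (toggles G y r + y q)
    y-solves-r = ∣-difference m (I r) (I p) (I d) (toggles G y r) (toggles G y p) (y q)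
      (subst (λ a → suc m ∣ a + toggles G y r) (bump-here I r _) (y-solves r))
      (y-solves-≢r p (r≢p ∘ sym))
      (subst (λ t → suc m ∣ I d + t) (toggles-d≡toggles-p+q y) (y-solves-≢r d (r≢d ∘ sym)))

    solves : ∀ v → suc m ∣ I v + toggles G+qr (compensated m y) v
    solves v = by-cases (v ≟ r)
      where
      by-cases : Dec (v ≡ r) → suc m ∣ I v + toggles G+qr (compensated m y) v
      by-cases (yes v≡r) = subst (λ u → suc m ∣ I u + toggles G+qr (compensated m y) u) (sym v≡r)
                                 (subst (λ t → suc m ∣ I r + t) (sym (toggles-G+qr-compensated-r m y))
                                        (∣-+-multiple (suc m) {I r} (y r) y-solves-r))
      by-cases (no v≢r)  = subst (λ t → suc m ∣ I v + t) (sym (toggles-G+qr-compensated m y v v≢r))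
                           (∣-+-multiple (suc m) {I v} (y r) (y-solves-≢r v v≢r))

  not-extremal : ∀ ℓ .{{_ : NonZero ℓ}} → ¬ Extremal n ℓ G
  not-extremal ℓ (naw , maximal) =
    <⇒≱ (edges-addEdge G q≢r (∨-conicalʳ _ _ r∉N[q])) (maximal G+qr (NAW-addEdge ℓ naw))

¬ComponentIsP2⇒second-neighbour : ∀ {n} (F : Graph n) {p q} → adj F p q ≡ true → (∀ u → u ≢ q → adj F p u ≡ false) →
                                  ¬ ComponentIsP2 F p → ∃ λ r → r ≢ p × adj F q r ≡ true
¬ComponentIsP2⇒second-neighbour F {p} {q} pq∈F only-q ¬P2
  with any? (λ r → ¬? (r ≟ p) ×-dec (adj F q r Bool.≟ true))
... | yes found = found
... | no none   = contradiction (q , p≢q , pq∈F , reachable-from-p) ¬P2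
  where
  p≢q : p ≢ q
  p≢q refl with () ← trans (sym (irrefl F p)) pq∈F

  only-p : ∀ u → adj F q u ≡ true → u ≡ p
  only-p u qu∈F with u ≟ p
  ... | yes u≡p = u≡p
  ... | no u≢p  = contradiction (u , u≢p , qu∈F) none

  only-q′ : ∀ u → adj F p u ≡ true → u ≡ q
  only-q′ u pu∈F with u ≟ q
  ... | yes u≡q = u≡q
  ... | no u≢q with () ← trans (sym (only-q u u≢q)) pu∈F

  reachable-from-p : ∀ u → Reach F p u → u ≡ p ⊎ u ≡ q
  reachable-from-p u here = inj₁ refl
  reachable-from-p u (step {u = w} p⇝w wu∈F) with reachable-from-p w p⇝w
  ... | inj₁ refl = inj₂ (only-q′ u wu∈F)
  ... | inj₂ refl = inj₁ (only-p u wu∈F)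

corollary3p8 : ∀ {n} (G : Graph n) → HasDominating G →
    (∃ λ (p : Fin n) → Pendant (complement G) p × ¬ ComponentIsP2 (complement G) p) →
    ∀ (ℓ : ℕ) .{{_ : NonZero ℓ}} → ¬ Extremal n ℓ G
corollary3p8 G (d , d-dom) (p , p-pendant , ¬P2)
  with q , pq∉G , only-q ← ∑-indicator≡1 (adj (complement G) p) p-pendant
  with r , r≢p , qr∉G ← ¬ComponentIsP2⇒second-neighbour (complement G) pq∉G only-q ¬P2
  = not-extremal G (dominating⇒closedNbr G d-dom)
      (λ v v≢q → trans (closedNbr-sym G v p) (trans (closedNbr≡not-complement G p v) (cong not (only-q v v≢q))))
      (trans (closedNbr-sym G q p) (trans (closedNbr≡not-complement G p q) (cong not pq∉G)))
      (trans (closedNbr≡not-complement G q r) (cong not qr∉G))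
      r≢p
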